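{- Let $n$ be an even perfect square. Then $D_{S(n)^*}=C_{S(n)^*}=4$.
   Context: $\mathbb Z_n=\mathbb Z/n\mathbb Z$; $S(n)^*=\{x^2:x\in\mathbb Z_n\}\setminus\{0\}$. For $A\subseteq\mathbb Z_n$, a subsequence $T$ of a sequence $(x_1,\dots,x_k)$ in $\mathbb Z_n$, with nonempty index set $I$, is an $A$-weighted zero-sum subsequence if there exist $a_i\in A$ ($i\in I$) with $\sum_{i\in I}a_ix_i=0$. $D_{S(n)^*}$ is the least positive integer $k$ such that every sequence of length $k$ in $\mathbb Z_n$ has an $S(n)^*$-weighted zero-sum subsequence; $C_{S(n)^*}$ is the least positive integer $k$ such that every sequence of length $k$ in $\mathbb Z_n$ has an $S(n)^*$-weighted zero-sum subsequence consisting of consecutive terms. -}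

module Defs where

open import Data.Nat using (ℕ; zero; suc; _+_; _*_; _≤_; _<_; NonZero)
open import Data.Nat.DivMod using (_%_)
open import Data.Fin using (Fin; toℕ)
import Data.Fin as F
open import Data.Bool using (Bool; true; false; if_then_else_)
open import Data.Product using (Σ; ∃; _×_; _,_)
open import Data.Empty using (⊥)
open import Relation.Nullary using (¬_)
open import Relation.Binary.PropositionalEquality using (_≡_)

-- Elements of ℤ_n are represented by Fin n (residues 0 … n-1).

SqStar : (n : ℕ) → .{{ _ : NonZero n }} → Fin n → Set
SqStar n a = (∃ λ (x : Fin n) → (toℕ x * toℕ x) % n ≡ toℕ a) × ¬ (toℕ a ≡ 0)

sumOver : ∀ {k} → (Fin k → Bool) → (Fin k → ℕ) → ℕ
sumOver {zero}  I f = 0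
sumOver {suc k} I f =
  (if I F.zero then f F.zero else 0) + sumOver (λ i → I (F.suc i)) (λ i → f (F.suc i))

Nonempty : ∀ {k} → (Fin k → Bool) → Set
Nonempty {k} I = ∃ λ (i : Fin k) → I i ≡ true

Consecutive : ∀ {k} → (Fin k → Bool) → Set
Consecutive {k} I = ∃ λ (l : ℕ) → ∃ λ (r : ℕ) →
  ∀ (i : Fin k) → (I i ≡ true → (l ≤ toℕ i × toℕ i ≤ r))
                × ((l ≤ toℕ i × toℕ i ≤ r) → I i ≡ true)

IsWeightedZeroSum : (n : ℕ) → .{{ _ : NonZero n }} → (A : Fin n → Set) →
  ∀ {k} → (Fin k → Fin n) → (Fin k → Bool) → Set
IsWeightedZeroSum n A {k} x I =
  Nonempty I ×
  (∃ λ (a : Fin k → Fin n) →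
     (∀ i → I i ≡ true → A (a i)) ×
     (sumOver I (λ i → toℕ (a i) * toℕ (x i)) % n ≡ 0))

DProp : (n : ℕ) → .{{ _ : NonZero n }} → (Fin n → Set) → ℕ → Set
DProp n A k = ∀ (x : Fin k → Fin n) → ∃ λ I → IsWeightedZeroSum n A x I

CProp : (n : ℕ) → .{{ _ : NonZero n }} → (Fin n → Set) → ℕ → Set
CProp n A k = ∀ (x : Fin k → Fin n) →
  ∃ λ I → Consecutive I × IsWeightedZeroSum n A x I

IsLeastPositive : (ℕ → Set) → ℕ → Set
IsLeastPositive P k = 1 ≤ k × P k × (∀ j → 1 ≤ j → j < k → ¬ P j)

D-is : (n : ℕ) → .{{ _ : NonZero n }} → (Fin n → Set) → ℕ → Set
D-is n A k = IsLeastPositive (DProp n A) k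

C-is : (n : ℕ) → .{{ _ : NonZero n }} → (Fin n → Set) → ℕ → Set
C-is n A k = IsLeastPositive (CProp n A) k

-- Write n = m² with m = 2t. Among four elements of ℤ_n some nonempty block of consecutive terms
-- sums to 0 modulo 4 (pigeonhole on the five prefix sums), and weighting the whole block by the
-- nonzero square t² gives a multiple of 4t² = n; so C ≤ 4, and D ≤ C.
-- Conversely, the Chinese remainder theorem over the primes of m yields a, b such that
-- x² + a y² + b z² ≡ 0 (mod m²) forces m ∣ x, y, z: locally x² + y² + z² at 2, and x² + A y² + p z²
-- with -A a non-residue at an odd prime p. A zero sum of (1, a, b) with square weights z² then has
-- m ∣ z, i.e. weight 0, at a selected term; as the D-property passes to longer sequences, D > 3.

module Submission where

open import Defs
open import Data.Nat using (ℕ; _*_; NonZero)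
open import Data.Nat.Divisibility using (_∣_)
open import Data.Product using (_×_)
open import Relation.Binary.PropositionalEquality using (_≡_)

open import Algebra.Properties.CommutativeSemigroup using (interchange)
open import Data.Bool using (Bool; true; false; if_then_else_; _∧_)
open import Data.Bool.Properties using (T-≡; T-∧)
open import Data.Fin as Fin using (Fin; toℕ; fromℕ<)
open import Data.Fin.Properties using (toℕ-fromℕ<; toℕ<n; toℕ-injective; injective⇒≤; pigeonhole; any?; ¬∀⟶∃¬)
open import Data.List using ([]; _∷_)
open import Data.List.Relation.Unary.All as All using (All; []; _∷_)
open import Data.Nat using (zero; suc; pred; _+_; _∸_; _≤_; _<_; _≤′_; ≤′-refl; ≤′-step; z≤n; s≤s; s≤s⁻¹; _≟_; _≤?_; _<?_; ≢-nonZero⁻¹)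
open import Data.List.Membership.DecPropositional _≟_ using (_∈?_)
open import Data.Nat.Coprimality as Coprime using (Coprime; coprime-Bézout; coprime-divisor)
open import Data.Nat.DivMod
open import Data.Nat.Divisibility
open import Data.Nat.GCD using (module Bézout)
open import Data.Nat.ListAction using (product)
open import Data.Nat.ListAction.Properties using (∈⇒∣product)
open import Data.Nat.Primality
open import Data.Nat.Primality.Factorisation using (PrimeFactorisation; factorise; factorisationHasAllPrimeFactors)
open PrimeFactorisation using (factors; factorsPrime; isFactorisation)
open import Data.Nat.Properties
open import Data.Nat.Tactic.RingSolver using (solve-∀)
open import Data.Product using (∃; ∃₂; _,_; proj₁; proj₂)
open import Data.Sum using (inj₁; inj₂; [_,_]′)
open import Function using (_∘_; id)
open import Function.Bundles using (Equivalence)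
open import Relation.Nullary using (¬_; Dec; does; yes; no; contradiction)
open import Relation.Nullary.Decidable using (dec-true; dec-false)
open import Relation.Binary.PropositionalEquality hiding (J)

-- Congruences modulo d

module _ {d : ℕ} .{{_ : NonZero d}} where

  %-cong-+ : ∀ {x x′ y y′} → x % d ≡ x′ % d → y % d ≡ y′ % d → (x + y) % d ≡ (x′ + y′) % d
  %-cong-+ {x} {x′} {y} {y′} ex ey = begin
    (x + y) % d             ≡⟨ %-distribˡ-+ x y d ⟩
    (x % d + y % d) % d     ≡⟨ cong₂ (λ u v → (u + v) % d) ex ey ⟩
    (x′ % d + y′ % d) % d   ≡⟨ %-distribˡ-+ x′ y′ d ⟨
    (x′ + y′) % d           ∎
    where open ≡-Reasoning

  %-cong-* : ∀ {x x′ y y′} → x % d ≡ x′ % d → y % d ≡ y′ % d → (x * y) % d ≡ (x′ * y′) % d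
  %-cong-* {x} {x′} {y} {y′} ex ey = begin
    (x * y) % d             ≡⟨ %-distribˡ-* x y d ⟩
    (x % d * (y % d)) % d   ≡⟨ cong₂ (λ u v → (u * v) % d) ex ey ⟩
    (x′ % d * (y′ % d)) % d ≡⟨ %-distribˡ-* x′ y′ d ⟨
    (x′ * y′) % d           ∎
    where open ≡-Reasoning

  -- a * pred d is an additive inverse of a modulo d.
  %-cancelˡ-+ : ∀ a {b c} → (a + b) % d ≡ (a + c) % d → b % d ≡ c % d
  %-cancelˡ-+ a {b} {c} e = begin
    b % d                          ≡⟨ %-remove-+ˡ b (n∣m*n a) ⟨
    (a * d + b) % d                ≡⟨ cong (_% d) (negate b) ⟩
    (a * pred d + (a + b)) % d     ≡⟨ %-cong-+ {a * pred d} refl e ⟩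
    (a * pred d + (a + c)) % d     ≡⟨ cong (_% d) (negate c) ⟨
    (a * d + c) % d                ≡⟨ %-remove-+ˡ c (n∣m*n a) ⟩
    c % d                          ∎
    where
    open ≡-Reasoning
    shuffle : ∀ a q x → a * suc q + x ≡ a * q + (a + x)
    shuffle = solve-∀
    negate : ∀ x → a * d + x ≡ a * pred d + (a + x)
    negate x = trans (cong (λ e → a * e + x) (sym (suc-pred d))) (shuffle a (pred d) x)

residue-unique : ∀ {d X A A′} .{{_ : NonZero d}} → A < d → A′ < d → (X + A) % d ≡ (X + A′) % d → A ≡ A′
residue-unique {d} {X} A<d A′<d e =
  trans (sym (m<n⇒m%n≡m A<d)) (trans (%-cancelˡ-+ {d} X e) (m<n⇒m%n≡m A′<d))

-- Consecutive zero sums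

sumOver-+ : ∀ {k} (I J K : Fin k → Bool) (f : Fin k → ℕ) →
  (∀ i → (if I i then f i else 0) + (if J i then f i else 0) ≡ (if K i then f i else 0)) →
  sumOver I f + sumOver J f ≡ sumOver K f
sumOver-+ {zero}  I J K f e = refl
sumOver-+ {suc k} I J K f e =
  trans (interchange +-commutativeSemigroup (if I Fin.zero then f Fin.zero else 0) (sumOver (I ∘ Fin.suc) (f ∘ Fin.suc))
                                            (if J Fin.zero then f Fin.zero else 0) (sumOver (J ∘ Fin.suc) (f ∘ Fin.suc)))
        (cong₂ _+_ (e Fin.zero) (sumOver-+ (I ∘ Fin.suc) (J ∘ Fin.suc) (K ∘ Fin.suc) (f ∘ Fin.suc) (e ∘ Fin.suc)))

sumOver-*ˡ : ∀ {k} (I : Fin k → Bool) c (f : Fin k → ℕ) → sumOver I (λ i → c * f i) ≡ c * sumOver I f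
sumOver-*ˡ {zero}  I c f = sym (*-zeroʳ c)
sumOver-*ˡ {suc k} I c f with I Fin.zero
... | true  = trans (cong (c * f Fin.zero +_) (sumOver-*ˡ (I ∘ Fin.suc) c (f ∘ Fin.suc)))
                    (sym (*-distribˡ-+ c (f Fin.zero) _))
... | false = sumOver-*ˡ (I ∘ Fin.suc) c (f ∘ Fin.suc)

below : ∀ {k} → ℕ → Fin k → Bool
below j i = does (toℕ i <? j)

between : ∀ {k} → ℕ → ℕ → Fin k → Bool
between l u i = does (l ≤? toℕ i) ∧ does (toℕ i ≤? u)

between-true : ∀ {k l u} (i : Fin k) → l ≤ toℕ i → toℕ i ≤ u → between l u i ≡ true
between-true {l = l} {u} i l≤i i≤u rewrite dec-true (l ≤? toℕ i) l≤i | dec-true (toℕ i ≤? u) i≤u = refl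

between-true⁻¹ : ∀ {k l u} (i : Fin k) → between l u i ≡ true → l ≤ toℕ i × toℕ i ≤ u
between-true⁻¹ {l = l} {u} i e
  with l≤i , i≤u ← Equivalence.to (T-∧ {does (l ≤? toℕ i)}) (Equivalence.from T-≡ e)
  = ≤ᵇ⇒≤ l (toℕ i) l≤i , ≤ᵇ⇒≤ (toℕ i) u i≤u

between-consecutive : ∀ {k} l u → Consecutive {k} (between l u)
between-consecutive l u = l , u , λ i → between-true⁻¹ i , λ (l≤i , i≤u) → between-true i l≤i i≤u

prefix+between : ∀ {k} (f : Fin k → ℕ) {l u} → l ≤ suc u →
  sumOver (below l) f + sumOver (between l u) f ≡ sumOver (below (suc u)) f
prefix+between f {l} {u} l≤1+u = sumOver-+ (below l) (between l u) (below (suc u)) f pointwise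
  where
  pointwise : ∀ i → (if below l i then f i else 0) + (if between l u i then f i else 0)
                  ≡ (if below (suc u) i then f i else 0)
  pointwise i with toℕ i <? l | toℕ i ≤? u
  ... | yes i<l | _ rewrite dec-true (toℕ i <? l) i<l | dec-false (l ≤? toℕ i) (<⇒≱ i<l)
                          | dec-true (toℕ i <? suc u) (<-≤-trans i<l l≤1+u) = +-identityʳ (f i)
  ... | no i≮l | yes i≤u rewrite dec-false (toℕ i <? l) i≮l | dec-true (l ≤? toℕ i) (≮⇒≥ i≮l)
                               | dec-true (toℕ i ≤? u) i≤u | dec-true (toℕ i <? suc u) (s≤s i≤u) = refl
  ... | no i≮l | no i≰u rewrite dec-false (toℕ i <? l) i≮l | dec-true (l ≤? toℕ i) (≮⇒≥ i≮l)
                              | dec-false (toℕ i ≤? u) i≰u | dec-false (toℕ i <? suc u) (i≰u ∘ s≤s⁻¹) = refl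

-- Pigeonhole on the d + 1 prefix sums modulo d.
consecutive-zeroSum : ∀ d .{{_ : NonZero d}} (f : Fin d → ℕ) →
  ∃₂ λ l u → l ≤ u × u < d × sumOver (between l u) f % d ≡ 0
consecutive-zeroSum d f with pigeonhole (n<1+n d) (λ j → fromℕ< (m%n<n (sumOver (below (toℕ j)) f) d))
... | i , Fin.suc j , i<1+j , same =
  toℕ i , toℕ j , s≤s⁻¹ i<1+j , toℕ<n j , trans (%-cancelˡ-+ {d} (prefix (toℕ i)) (begin
    (prefix (toℕ i) + block) % d ≡⟨ cong (_% d) (prefix+between f (<⇒≤ i<1+j)) ⟩
    prefix (suc (toℕ j)) % d     ≡⟨ residues-agree ⟨
    prefix (toℕ i) % d           ≡⟨ cong (_% d) (+-identityʳ _) ⟨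
    (prefix (toℕ i) + 0) % d     ∎)) (n∣m⇒m%n≡0 0 d (d ∣0))
  where
  open ≡-Reasoning
  prefix : ℕ → ℕ
  prefix j = sumOver (below j) f
  block : ℕ
  block = sumOver (between (toℕ i) (toℕ j)) f
  residues-agree : prefix (toℕ i) % d ≡ prefix (suc (toℕ j)) % d
  residues-agree = trans (sym (toℕ-fromℕ< _)) (trans (cong toℕ same) (toℕ-fromℕ< _))

C-upperBound : ∀ {n} .{{_ : NonZero n}} {A : Fin n → Set} d .{{_ : NonZero d}} (w : Fin n) →
  A w → n ∣ toℕ w * d → CProp n A d
C-upperBound {n} d w Aw n∣wd x with consecutive-zeroSum d (toℕ ∘ x)
... | l , u , l≤u , u<d , block≡0 =
  between l u , between-consecutive l u ,
  (first , between-true first (≤-reflexive (sym first≡l)) (≤-trans (≤-reflexive first≡l) l≤u)) ,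
  (λ _ → w) , (λ _ _ → Aw) , n∣m⇒m%n≡0 _ n (subst (n ∣_) (sym (sumOver-*ˡ (between l u) (toℕ w) (toℕ ∘ x))) n∣w*block)
  where
  first : Fin d
  first = fromℕ< (≤-<-trans l≤u u<d)
  first≡l : toℕ first ≡ l
  first≡l = toℕ-fromℕ< _
  n∣w*block : n ∣ toℕ w * sumOver (between l u) (toℕ ∘ x)
  n∣w*block = ∣-trans n∣wd (*-monoʳ-∣ (toℕ w) (m%n≡0⇒n∣m _ d block≡0))

-- Divisibility, inverses and the Chinese remainder theorem

∣m+n∣n⇒∣m : ∀ {d m n} → d ∣ m + n → d ∣ n → d ∣ m
∣m+n∣n⇒∣m {d} {m} {n} d∣m+n = ∣m+n∣m⇒∣n (subst (d ∣_) (+-comm m n) d∣m+n)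

prime-∣-square : ∀ {p x} → Prime p → p ∣ x * x → p ∣ x
prime-∣-square {x = x} p-prime p∣x² = [ id , id ]′ (euclidsLemma x x p-prime p∣x²)

prime⇒square≢0 : ∀ {p} → Prime p → NonZero (p * p)
prime⇒square≢0 {p} p-prime = m*n≢0 p p {{prime⇒nonZero p-prime}} {{prime⇒nonZero p-prime}}

prime∤⇒coprime : ∀ {p n} → Prime p → ¬ p ∣ n → Coprime n p
prime∤⇒coprime p-prime p∤n (i∣n , i∣p) with prime⇒irreducible p-prime i∣p
... | inj₁ i≡1 = i≡1
... | inj₂ refl = contradiction i∣n p∤n

coprime-*ˡ : ∀ {a b c} → Coprime a c → Coprime b c → Coprime (a * b) c
coprime-*ˡ {a} {b} a⊥c b⊥c {i} (i∣ab , i∣c) = b⊥c (coprime-divisor i⊥a i∣ab , i∣c)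
  where
  i⊥a : Coprime i a
  i⊥a (j∣i , j∣a) = a⊥c (j∣a , ∣-trans j∣i i∣c)

inverse-mod : ∀ {a q} .{{_ : NonZero q}} → Coprime a q → ∃ λ u → (u * a) % q ≡ 1 % q
inverse-mod {q = zero} _ = contradiction refl (≢-nonZero⁻¹ 0)
inverse-mod {a} {q@(suc q′)} a⊥q with coprime-Bézout a⊥q
... | Bézout.+- x y 1+yq≡xa = x , (begin
  (x * a) % q      ≡⟨ cong (_% q) 1+yq≡xa ⟨
  (1 + y * q) % q  ≡⟨ [m+kn]%n≡m%n 1 y q ⟩
  1 % q            ∎)
  where open ≡-Reasoning
-- Here x * a ≡ -1 (mod q), so q′ * x ≡ -x is an inverse.
... | Bézout.-+ x y 1+xa≡yq = q′ * x , %-cancelˡ-+ q′ (begin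
  (q′ + q′ * x * a) % q   ≡⟨ cong (_% q) (factor q′ x a) ⟩
  (q′ * (1 + x * a)) % q  ≡⟨ cong (λ t → (q′ * t) % q) 1+xa≡yq ⟩
  (q′ * (y * q)) % q      ≡⟨ cong (_% q) (*-assoc q′ y q) ⟨
  (q′ * y * q) % q        ≡⟨ m*n%n≡0 (q′ * y) q ⟩
  0                       ≡⟨ n%n≡0 q ⟨
  q % q                   ≡⟨ cong (_% q) (+-comm 1 q′) ⟩
  (q′ + 1) % q            ∎)
  where
  open ≡-Reasoning
  factor : ∀ q′ x a → q′ + q′ * x * a ≡ q′ * (1 + x * a)
  factor = solve-∀

chinese-remainder : ∀ {M q} .{{_ : NonZero q}} → Coprime M q → ∀ a A → ∃ λ s → (a + M * s) % q ≡ A % q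
chinese-remainder {q = zero} _ _ _ = contradiction refl (≢-nonZero⁻¹ 0)
chinese-remainder {M} {q@(suc q′)} M⊥q a A = u * t , (begin
  (a + M * (u * t)) % q  ≡⟨ %-cong-+ {q} {a} {a} refl M*u*t≡t ⟩
  (a + t) % q            ≡⟨ cong (_% q) (rearrange a A q′) ⟩
  (A + a * q) % q        ≡⟨ [m+kn]%n≡m%n A a q ⟩
  A % q                  ∎)
  where
  open ≡-Reasoning
  u = proj₁ (inverse-mod M⊥q)
  t = A + q′ * a
  rearrange : ∀ a A q′ → a + (A + q′ * a) ≡ A + a * suc q′
  rearrange = solve-∀
  swap : ∀ M u t → M * (u * t) ≡ u * M * t
  swap = solve-∀
  M*u*t≡t : (M * (u * t)) % q ≡ t % q
  M*u*t≡t = begin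
    (M * (u * t)) % q  ≡⟨ cong (_% q) (swap M u t) ⟩
    (u * M * t) % q    ≡⟨ %-cong-* {q} {u * M} {1} {t} {t} (proj₂ (inverse-mod M⊥q)) refl ⟩
    (1 * t) % q        ≡⟨ cong (_% q) (*-identityˡ t) ⟩
    t % q              ∎

-- Anisotropic diagonal ternary forms modulo q²

form : ℕ → ℕ → ℕ → ℕ → ℕ → ℕ
form a b x y z = x * x + a * (y * y) + b * (z * z)

Anisotropic : ℕ → ℕ → ℕ → Set
Anisotropic q a b = ∀ x y z → q * q ∣ form a b x y z → q ∣ x × q ∣ y × q ∣ z

anisotropic-resp-% : ∀ {q a b a′ b′} .{{_ : NonZero (q * q)}} → Anisotropic q a b →
  a % (q * q) ≡ a′ % (q * q) → b % (q * q) ≡ b′ % (q * q) → Anisotropic q a′ b′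
anisotropic-resp-% {q} {a} {b} {a′} {b′} aniso a≡a′ b≡b′ x y z q²∣form =
  aniso x y z (m%n≡0⇒n∣m _ _ (trans same-form (n∣m⇒m%n≡0 _ _ q²∣form)))
  where
  same-form : form a b x y z % (q * q) ≡ form a′ b′ x y z % (q * q)
  same-form = %-cong-+ (%-cong-+ refl (%-cong-* a≡a′ refl)) (%-cong-* b≡b′ refl)

anisotropic[1] : ∀ a b → Anisotropic 1 a b
anisotropic[1] a b x y z _ = 1∣ x , 1∣ y , 1∣ z

square-* : ∀ p q → (p * q) * (p * q) ≡ (p * p) * (q * q)
square-* = solve-∀

form-homogeneous : ∀ a b x y z q → form a b (x * q) (y * q) (z * q) ≡ form a b x y z * (q * q)
form-homogeneous = expanded
  where
  expanded : ∀ a b x y z q → (x * q) * (x * q) + a * ((y * q) * (y * q)) + b * ((z * q) * (z * q))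
                           ≡ (x * x + a * (y * y) + b * (z * z)) * (q * q)
  expanded = solve-∀

-- If (pq)² divides the form at (x, y, z) = q(x′, y′, z′), then p² divides it at (x′, y′, z′).
anisotropic-* : ∀ {p q a b} .{{_ : NonZero q}} → Anisotropic p a b → Anisotropic q a b → Anisotropic (p * q) a b
anisotropic-* {p} {q} {a} {b} aniso-p aniso-q x y z pq²∣form
  with aniso-q x y z (∣-trans (n∣m*n (p * p)) (subst (_∣ form a b x y z) (square-* p q) pq²∣form))
... | divides x′ refl , divides y′ refl , divides z′ refl
  with p∣x′ , p∣y′ , p∣z′ ← aniso-p x′ y′ z′ (*-cancelʳ-∣ (q * q) {{m*n≢0 q q}}
         (subst₂ _∣_ (square-* p q) (form-homogeneous a b x′ y′ z′ q) pq²∣form))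
  = *-monoˡ-∣ q p∣x′ , *-monoˡ-∣ q p∣y′ , *-monoˡ-∣ q p∣z′

anisotropic-product : ∀ {a b} ps → All Prime ps → All (λ p → Anisotropic p a b) ps → Anisotropic (product ps) a b
anisotropic-product {a} {b} []       []           []               = anisotropic[1] a b
anisotropic-product {a} {b} (p ∷ ps) (_ ∷ primes) (aniso ∷ anisos) =
  anisotropic-* {p} {product ps} {a} {b} {{productOfPrimes≢0 primes}} aniso (anisotropic-product {a} {b} ps primes anisos)

bit-square : ∀ r → r < 2 → (r * r) % 4 ≡ r % 4
bit-square 0 _ = refl
bit-square 1 _ = refl
bit-square (suc (suc _)) (s≤s (s≤s ()))

square%4 : ∀ x → (x * x) % 4 ≡ (x % 2) % 4
square%4 x = begin
  (x * x) % 4                        ≡⟨ cong (λ w → (w * w) % 4) (m≡m%n+[m/n]*n x 2) ⟩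
  ((r + q * 2) * (r + q * 2)) % 4    ≡⟨ cong (_% 4) (expand r q) ⟩
  (r * r + (r * q + q * q) * 4) % 4  ≡⟨ [m+kn]%n≡m%n (r * r) (r * q + q * q) 4 ⟩
  (r * r) % 4                        ≡⟨ bit-square r (m%n<n x 2) ⟩
  r % 4                              ∎
  where
  open ≡-Reasoning
  r = x % 2
  q = x / 2
  expand : ∀ r q → (r + q * 2) * (r + q * 2) ≡ r * r + (r * q + q * q) * 4
  expand = solve-∀

-- A square is 0 or 1 modulo 4, so three squares can only sum to 0 modulo 4 if all are even.
anisotropic[2] : Anisotropic 2 1 1
anisotropic[2] x y z 4∣form = m%n≡0⇒n∣m x 2 x%2≡0 , m%n≡0⇒n∣m y 2 y%2≡0 , m%n≡0⇒n∣m z 2 z%2≡0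
  where
  bit≤1 : ∀ w → w % 2 ≤ 1
  bit≤1 w = s≤s⁻¹ (m%n<n w 2)
  parities : ℕ
  parities = x % 2 + y % 2 + z % 2
  parities<4 : parities < 4
  parities<4 = s≤s (+-mono-≤ (+-mono-≤ (bit≤1 x) (bit≤1 y)) (bit≤1 z))
  square%4′ : ∀ w → (1 * (w * w)) % 4 ≡ (w % 2) % 4
  square%4′ w = trans (cong (_% 4) (*-identityˡ (w * w))) (square%4 w)
  squares≡parities : form 1 1 x y z % 4 ≡ parities % 4
  squares≡parities =
    %-cong-+ {4} {x * x + 1 * (y * y)} {x % 2 + y % 2} {1 * (z * z)} {z % 2}
      (%-cong-+ {4} {x * x} {x % 2} {1 * (y * y)} {y % 2} (square%4 x) (square%4′ y)) (square%4′ z)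
  parities≡0 : parities ≡ 0
  parities≡0 = begin
    parities                     ≡⟨ m<n⇒m%n≡m parities<4 ⟨
    parities % 4                 ≡⟨ squares≡parities ⟨
    form 1 1 x y z % 4           ≡⟨ n∣m⇒m%n≡0 _ 4 4∣form ⟩
    0                            ∎
    where open ≡-Reasoning
  x%2≡0 : x % 2 ≡ 0
  x%2≡0 = m+n≡0⇒m≡0 (x % 2) (m+n≡0⇒m≡0 (x % 2 + y % 2) parities≡0)
  y%2≡0 : y % 2 ≡ 0
  y%2≡0 = m+n≡0⇒n≡0 (x % 2) (m+n≡0⇒m≡0 (x % 2 + y % 2) parities≡0)
  z%2≡0 : z % 2 ≡ 0
  z%2≡0 = m+n≡0⇒n≡0 (x % 2 + y % 2) parities≡0

prime≢2⇒odd : ∀ {p} → Prime p → p ≢ 2 → p ≡ 1 + p / 2 * 2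
prime≢2⇒odd {p} p-prime p≢2 = trans (m≡m%n+[m/n]*n p 2) (cong (_+ p / 2 * 2) (parity (p % 2) refl (m%n<n p 2)))
  where
  parity : ∀ r → p % 2 ≡ r → r < 2 → p % 2 ≡ 1
  parity 0 p%2≡0 _ = [ (λ ()) , (λ 2≡p → contradiction (sym 2≡p) p≢2) ]′
                       (prime⇒irreducible p-prime (m%n≡0⇒n∣m p 2 p%2≡0))
  parity 1 p%2≡1 _ = p%2≡1
  parity (suc (suc _)) _ (s≤s (s≤s ()))

-- Replacing v by p - v if necessary.
small-square-root : ∀ {p k} .{{_ : NonZero p}} → p ≡ 1 + k * 2 → ∀ v → v < p →
  ∃ λ h → h ≤ k × (h * h) % p ≡ (v * v) % p
small-square-root {p} {k} p≡1+2k v v<p with v ≤? k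
... | yes v≤k = v , v≤k , refl
... | no v≰k = w , w≤k , (begin
  (w * w) % p               ≡⟨ [m+kn]%n≡m%n (w * w) (2 * v) p ⟨
  (w * w + 2 * v * p) % p   ≡⟨ cong (_% p) (subst (λ q → w * w + 2 * v * q ≡ v * v + q * q) v+w≡p (reflect v w)) ⟩
  (v * v + p * p) % p       ≡⟨ [m+kn]%n≡m%n (v * v) p p ⟩
  (v * v) % p               ∎)
  where
  open ≡-Reasoning
  w = p ∸ v
  v+w≡p : v + w ≡ p
  v+w≡p = m+[n∸m]≡n (<⇒≤ v<p)
  reflect : ∀ v w → w * w + 2 * v * (v + w) ≡ v * v + (v + w) * (v + w)
  reflect = solve-∀
  w≤k : w ≤ k
  w≤k = ≤-trans (∸-monoʳ-≤ p (≰⇒> v≰k)) (≤-reflexive (begin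
    p ∸ suc k                ≡⟨ cong (_∸ suc k) p≡1+2k ⟩
    k * 2 ∸ k                ≡⟨ cong (_∸ k) (*-comm k 2) ⟩
    (k + (k + 0)) ∸ k        ≡⟨ m+n∸m≡n k (k + 0) ⟩
    k + 0                    ≡⟨ +-identityʳ k ⟩
    k                        ∎))

odd-prime-large : ∀ {p} → Prime p → ∀ k → p ≡ 1 + k * 2 → suc k < p
odd-prime-large p-prime zero p≡1 = contradiction (subst Prime p≡1 p-prime) ¬prime[1]
odd-prime-large {p} p-prime k@(suc _) p≡1+2k =
  subst (suc k <_) (sym p≡1+2k) (s≤s (m<m*n k 2 (s≤s (s≤s z≤n))))

module _ {p : ℕ} (p-prime : Prime p) where

  private instance
    p≢0 : NonZero p
    p≢0 = prime⇒nonZero p-prime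

  HasRoot : Fin p → Set
  HasRoot A = ∃ λ (y : Fin p) → p ∣ toℕ y * toℕ y + toℕ A

  hasRoot? : ∀ A → Dec (HasRoot A)
  hasRoot? A = any? (λ y → p ∣? toℕ y * toℕ y + toℕ A)

  -- Roots y of y² + A ≡ 0 can be taken in [0, (p - 1) / 2], and distinct A have distinct roots.
  not-every-residue-negated-square : p ≢ 2 → ¬ (∀ A → HasRoot A)
  not-every-residue-negated-square p≢2 everyRoot =
    contradiction (injective⇒≤ root-injective) (<⇒≱ (odd-prime-large p-prime k p≡1+2k))
    where
    k = p / 2
    p≡1+2k : p ≡ 1 + k * 2
    p≡1+2k = prime≢2⇒odd p-prime p≢2
    smallRoot : (A : Fin p) → ∃ λ h → h ≤ k × (h * h + toℕ A) % p ≡ 0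
    smallRoot A with y , p∣y²+A ← everyRoot A
                with h , h≤k , h²≡y² ← small-square-root p≡1+2k (toℕ y) (toℕ<n y)
      = h , h≤k , trans (%-cong-+ {p} {h * h} {toℕ y * toℕ y} {toℕ A} {toℕ A} h²≡y² refl) (n∣m⇒m%n≡0 _ p p∣y²+A)
    root : Fin p → Fin (suc k)
    root A = fromℕ< (s≤s (proj₁ (proj₂ (smallRoot A))))
    root-injective : ∀ {A A′} → root A ≡ root A′ → A ≡ A′
    root-injective {A} {A′} e = toℕ-injective (residue-unique (toℕ<n A) (toℕ<n A′) (trans rootA (sym rootA′)))
      where
      h = proj₁ (smallRoot A)
      h′ = proj₁ (smallRoot A′)
      h≡h′ : h ≡ h′
      h≡h′ = trans (sym (toℕ-fromℕ< _)) (trans (cong toℕ e) (toℕ-fromℕ< _))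
      rootA : (h * h + toℕ A) % p ≡ 0
      rootA = proj₂ (proj₂ (smallRoot A))
      rootA′ : (h * h + toℕ A′) % p ≡ 0
      rootA′ = subst (λ v → (v * v + toℕ A′) % p ≡ 0) (sym h≡h′) (proj₂ (proj₂ (smallRoot A′)))

  negated-nonsquare : p ≢ 2 → ∃ λ A → ∀ y → ¬ p ∣ y * y + A
  negated-nonsquare p≢2 with A , noRoot ← ¬∀⟶∃¬ p HasRoot hasRoot? (not-every-residue-negated-square p≢2) =
    toℕ A , λ y p∣y²+A → noRoot (fromℕ< (m%n<n y p) , subst (λ v → p ∣ v * v + toℕ A) (sym (toℕ-fromℕ< (m%n<n y p))) (reduce y p∣y²+A))
    where
    reduce : ∀ y → p ∣ y * y + toℕ A → p ∣ (y % p) * (y % p) + toℕ A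
    reduce y p∣y²+A = m%n≡0⇒n∣m _ p (trans
      (%-cong-+ {p} {y % p * (y % p)} {y * y} {toℕ A} {toℕ A} (sym (%-distribˡ-* y y p)) refl)
      (n∣m⇒m%n≡0 _ p p∣y²+A))

  -- Modulo p the form is x² + A y², which has no zero with y invertible; then p² ∣ p z².
  anisotropic-nonsquare : ∀ {A} → (∀ y → ¬ p ∣ y * y + A) → Anisotropic p A p
  anisotropic-nonsquare {A} nonsquare x y z p²∣form = p∣x , p∣y , p∣z
    where
    p∣x²+Ay² : p ∣ x * x + A * (y * y)
    p∣x²+Ay² = ∣m+n∣n⇒∣m (m*n∣⇒m∣ p p p²∣form) (m∣m*n (z * z))
    p∣y : p ∣ y
    p∣y with p ∣? y
    ... | yes p∣y = p∣y
    ... | no p∤y = contradiction (m%n≡0⇒n∣m _ p root) (nonsquare (u * x))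
      where
      open ≡-Reasoning
      u = proj₁ (inverse-mod (prime∤⇒coprime p-prime p∤y))
      uy≡1 : (u * y) % p ≡ 1 % p
      uy≡1 = proj₂ (inverse-mod (prime∤⇒coprime p-prime p∤y))
      scale : ∀ u x y A → u * u * (x * x + A * (y * y)) ≡ (u * x) * (u * x) + A * ((u * y) * (u * y))
      scale = solve-∀
      root : ((u * x) * (u * x) + A) % p ≡ 0
      root = begin
        ((u * x) * (u * x) + A) % p                  ≡⟨ cong (λ t → ((u * x) * (u * x) + t) % p) (*-identityʳ A) ⟨
        ((u * x) * (u * x) + A * 1) % p              ≡⟨ %-cong-+ {p} {(u * x) * (u * x)} {(u * x) * (u * x)}
                                                          refl (%-cong-* {p} {A} {A} refl (%-cong-* {p} {u * y} {1} {u * y} {1} uy≡1 uy≡1)) ⟨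
        ((u * x) * (u * x) + A * ((u * y) * (u * y))) % p ≡⟨ cong (_% p) (scale u x y A) ⟨
        (u * u * (x * x + A * (y * y))) % p          ≡⟨ n∣m⇒m%n≡0 _ p (∣n⇒∣m*n (u * u) p∣x²+Ay²) ⟩
        0                                            ∎
    p∣x : p ∣ x
    p∣x = prime-∣-square p-prime (∣m+n∣n⇒∣m p∣x²+Ay² (∣n⇒∣m*n A (∣m⇒∣m*n y p∣y)))
    p²∣x²+Ay² : p * p ∣ x * x + A * (y * y)
    p²∣x²+Ay² = ∣m∣n⇒∣m+n (*-pres-∣ p∣x p∣x) (∣n⇒∣m*n A (*-pres-∣ p∣y p∣y))
    p∣z : p ∣ z
    p∣z = prime-∣-square p-prime (*-cancelˡ-∣ p (∣m+n∣m⇒∣n p²∣form p²∣x²+Ay²))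

anisotropic-prime : ∀ {p} → Prime p → ∃₂ λ a b → Anisotropic p a b
anisotropic-prime {p} p-prime with p ≟ 2
... | yes refl = 1 , 1 , anisotropic[2]
... | no p≢2 = let A , nonsquare = negated-nonsquare p-prime p≢2 in A , p , anisotropic-nonsquare p-prime nonsquare

anisotropic-shift : ∀ {q a b K} s s′ → Prime q → Anisotropic q a b → q ∣ K →
  Anisotropic q (a + K * K * s) (b + K * K * s′)
anisotropic-shift {q} {a} {b} {K} s s′ q-prime aniso q∣K =
  anisotropic-resp-% {{q²≢0}} aniso (sym (%-remove-+ʳ a {{q²≢0}} (q²∣ s))) (sym (%-remove-+ʳ b {{q²≢0}} (q²∣ s′)))
  where
  q²≢0 = prime⇒square≢0 q-prime
  q²∣ : ∀ t → q * q ∣ K * K * t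
  q²∣ t = ∣m⇒∣m*n t (*-pres-∣ q∣K q∣K)

-- Chinese remaindering modulo the p² for the distinct primes p in the list.
anisotropic-common : ∀ ps → All Prime ps → ∃₂ λ a b → All (λ p → Anisotropic p a b) ps
anisotropic-common []       []                 = 1 , 1 , []
anisotropic-common (p ∷ ps) (p-prime ∷ primes) with anisotropic-common ps primes | p ∈? ps
... | a , b , anisos | yes p∈ps = a , b , All.lookup anisos p∈ps ∷ anisos
... | a , b , anisos | no p∉ps  = a + P² * s , b + P² * s′ , aniso-p ∷ anisos-ps
  where
  instance
    p²≢0 : NonZero (p * p)
    p²≢0 = prime⇒square≢0 p-prime
  P = product ps
  P² = P * P
  P⊥p : Coprime P p
  P⊥p = prime∤⇒coprime p-prime (λ p∣P → p∉ps (factorisationHasAllPrimeFactors p-prime p∣P primes))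
  P²⊥p² : Coprime P² (p * p)
  P²⊥p² = Coprime.sym (coprime-*ˡ p⊥P² p⊥P²)
    where
    p⊥P² : Coprime p P²
    p⊥P² = Coprime.sym (coprime-*ˡ P⊥p P⊥p)
  local : ∃₂ λ A B → Anisotropic p A B
  local = anisotropic-prime p-prime
  A = proj₁ local
  B = proj₁ (proj₂ local)
  s = proj₁ (chinese-remainder P²⊥p² a A)
  s′ = proj₁ (chinese-remainder P²⊥p² b B)
  aniso-p : Anisotropic p (a + P² * s) (b + P² * s′)
  aniso-p = anisotropic-resp-% {p} {A} {B} (proj₂ (proj₂ local)) (sym (proj₂ (chinese-remainder P²⊥p² a A))) (sym (proj₂ (chinese-remainder P²⊥p² b B)))
  anisos-ps : All (λ q → Anisotropic q (a + P² * s) (b + P² * s′)) ps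
  anisos-ps = All.tabulate λ {q} q∈ps →
    anisotropic-shift {q} {a} {b} {P} s s′ (All.lookup primes q∈ps) (All.lookup anisos q∈ps) (∈⇒∣product q∈ps)

anisotropic-exists : ∀ m .{{_ : NonZero m}} → ∃₂ λ a b → Anisotropic m a b
anisotropic-exists m with a , b , anisos ← anisotropic-common (factors (factorise m)) (factorsPrime (factorise m)) =
  a , b , subst (λ q → Anisotropic q a b) (sym (isFactorisation (factorise m)))
                (anisotropic-product {a} {b} (factors (factorise m)) (factorsPrime (factorise m)) anisos)

-- Weighted zero sums

module _ {n : ℕ} .{{_ : NonZero n}} {A : Fin n → Set} where

  C⇒D : ∀ {k} → CProp n A k → DProp n A k
  C⇒D C x with I , _ , zeroSum ← C x = I , zeroSum

  weightedZeroSum-tail : ∀ {k} (x : Fin (suc k) → Fin n) {I} →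
    IsWeightedZeroSum n A (x ∘ Fin.suc) I → ∃ λ J → IsWeightedZeroSum n A x J
  weightedZeroSum-tail {k} x {I} ((i , i∈I) , a , a∈A , sum≡0) = J , (Fin.suc i , i∈I) , a′ , a′∈A , sum≡0
    where
    J : Fin (suc k) → Bool
    J Fin.zero    = false
    J (Fin.suc i) = I i
    a′ : Fin (suc k) → Fin n
    a′ Fin.zero    = x Fin.zero
    a′ (Fin.suc i) = a i
    a′∈A : ∀ i → J i ≡ true → A (a′ i)
    a′∈A Fin.zero    ()
    a′∈A (Fin.suc i) = a∈A i

  DProp-suc : ∀ {k} → DProp n A k → DProp n A (suc k)
  DProp-suc D x = weightedZeroSum-tail x (proj₂ (D (x ∘ Fin.suc)))

  DProp-mono : ∀ {j k} → j ≤′ k → DProp n A j → DProp n A k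
  DProp-mono ≤′-refl        D = D
  DProp-mono (≤′-step j≤′k) D = DProp-suc (DProp-mono j≤′k D)

C-upperBound-evenSquare : ∀ m .{{_ : NonZero (m * m)}} → 2 ∣ m → CProp (m * m) (SqStar (m * m)) 4
C-upperBound-evenSquare .(t * 2) (divides t refl) = C-upperBound {A = SqStar n} 4 w (t-square , ≢-nonZero⁻¹ (t * t) ∘ trans (sym w≡t²)) n∣w*4
  where
  n = (t * 2) * (t * 2)
  instance
    t≢0 : NonZero t
    t≢0 = m*n≢0⇒m≢0 t {2} {{m*n≢0⇒m≢0 (t * 2)}}
    t²≢0 : NonZero (t * t)
    t²≢0 = m*n≢0 t t
  n≡t²*4 : n ≡ t * t * 4
  n≡t²*4 = regroup t
    where
    regroup : ∀ t → (t * 2) * (t * 2) ≡ t * t * 4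
    regroup = solve-∀
  t²<n : t * t < n
  t²<n = subst (t * t <_) (sym n≡t²*4) (m<m*n (t * t) 4 (s≤s (s≤s z≤n)))
  t<n : t < n
  t<n = ≤-<-trans (m≤m*n t t) t²<n
  w : Fin n
  w = fromℕ< t²<n
  w≡t² : toℕ w ≡ t * t
  w≡t² = toℕ-fromℕ< t²<n
  t-square : ∃ λ (x : Fin n) → (toℕ x * toℕ x) % n ≡ toℕ w
  t-square = fromℕ< t<n , trans (cong (λ v → (v * v) % n) (toℕ-fromℕ< t<n)) (trans (m<n⇒m%n≡m t²<n) (sym w≡t²))
  n∣w*4 : n ∣ toℕ w * 4
  n∣w*4 = ∣-reflexive (trans n≡t²*4 (cong (_* 4) (sym w≡t²)))

coefficient : ℕ → ℕ → Fin 3 → ℕ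
coefficient a b Fin.zero              = 1
coefficient a b (Fin.suc Fin.zero)    = a
coefficient a b (Fin.suc (Fin.suc _)) = b

module _ (m : ℕ) .{{_ : NonZero (m * m)}} where

  private
    n = m * m

  residue : ℕ → Fin n
  residue c = fromℕ< (m%n<n c n)

  selectedTerm : (selected : Bool) (w : Fin n) (c : ℕ) → (selected ≡ true → SqStar n w) →
    ∃ λ z → (if selected then toℕ w * toℕ (residue c) else 0) % n ≡ (c * (z * z)) % n × (selected ≡ true → ¬ m ∣ z)
  selectedTerm false w c _ = 0 , cong (_% n) (sym (*-zeroʳ c)) , λ ()
  selectedTerm true  w c square with (y , y²≡w) , w≢0 ← square refl =
    toℕ y , term≡ , λ _ m∣y → w≢0 (trans (sym y²≡w) (n∣m⇒m%n≡0 _ n (*-pres-∣ m∣y m∣y)))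
    where
    term≡ : (toℕ w * toℕ (residue c)) % n ≡ (c * (toℕ y * toℕ y)) % n
    term≡ = begin
      (toℕ w * toℕ (residue c)) % n          ≡⟨ cong (λ v → (toℕ w * v) % n) (toℕ-fromℕ< (m%n<n c n)) ⟩
      (toℕ w * (c % n)) % n                  ≡⟨ cong (λ v → (v * (c % n)) % n) y²≡w ⟨
      ((toℕ y * toℕ y) % n * (c % n)) % n    ≡⟨ %-distribˡ-* (toℕ y * toℕ y) c n ⟨
      (toℕ y * toℕ y * c) % n                ≡⟨ cong (_% n) (*-comm (toℕ y * toℕ y) c) ⟩
      (c * (toℕ y * toℕ y)) % n              ∎
      where open ≡-Reasoning

  sumOver₃≡form : ∀ a b (I : Fin 3 → Bool) (t z : Fin 3 → ℕ) →
    (∀ j → (if I j then t j else 0) % n ≡ (coefficient a b j * (z j * z j)) % n) →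
    sumOver I t % n ≡ form a b (z Fin.zero) (z (Fin.suc Fin.zero)) (z (Fin.suc (Fin.suc Fin.zero))) % n
  sumOver₃≡form a b I t z terms = begin
    (term 0F + (term 1F + (term 2F + 0))) % n                        ≡⟨ termwise ⟩
    (1 * (z 0F * z 0F) + (a * (z 1F * z 1F) + (b * (z 2F * z 2F) + 0))) % n ≡⟨ cong (_% n) (as-sum a b (z 0F) (z 1F) (z 2F)) ⟨
    form a b (z 0F) (z 1F) (z 2F) % n                                 ∎
    where
    open ≡-Reasoning
    0F 1F 2F : Fin 3
    0F = Fin.zero
    1F = Fin.suc Fin.zero
    2F = Fin.suc (Fin.suc Fin.zero)
    term : Fin 3 → ℕ
    term j = if I j then t j else 0
    termwise : (term 0F + (term 1F + (term 2F + 0))) % n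
             ≡ (1 * (z 0F * z 0F) + (a * (z 1F * z 1F) + (b * (z 2F * z 2F) + 0))) % n
    termwise = %-cong-+ {n} {term 0F} {1 * (z 0F * z 0F)} (terms 0F)
                 (%-cong-+ {n} {term 1F} {a * (z 1F * z 1F)} (terms 1F)
                   (%-cong-+ {n} {term 2F} {b * (z 2F * z 2F)} {0} {0} (terms 2F) refl))
    as-sum : ∀ a b x y z → x * x + a * (y * y) + b * (z * z) ≡ 1 * (x * x) + (a * (y * y) + (b * (z * z) + 0))
    as-sum = solve-∀

  D-lowerBound : ¬ DProp n (SqStar n) 3
  D-lowerBound D
    with a , b , aniso ← anisotropic-exists m {{m*n≢0⇒m≢0 m}}
    with I , (i , i∈I) , w , w∈S , sum≡0 ← D (residue ∘ coefficient a b)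
    = proj₂ (proj₂ (witness i)) i∈I (m∣z i)
    where
    weighted : Fin 3 → ℕ
    weighted j = toℕ (w j) * toℕ (residue (coefficient a b j))
    witness : ∀ j → ∃ λ z → (if I j then weighted j else 0) % n ≡ (coefficient a b j * (z * z)) % n
                          × (I j ≡ true → ¬ m ∣ z)
    witness j = selectedTerm (I j) (w j) (coefficient a b j) (w∈S j)
    z : Fin 3 → ℕ
    z j = proj₁ (witness j)
    z₀ z₁ z₂ : ℕ
    z₀ = z Fin.zero
    z₁ = z (Fin.suc Fin.zero)
    z₂ = z (Fin.suc (Fin.suc Fin.zero))
    n∣form : n ∣ form a b z₀ z₁ z₂
    n∣form = m%n≡0⇒n∣m _ n (trans (sym (sumOver₃≡form a b I weighted z (proj₁ ∘ proj₂ ∘ witness))) sum≡0)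
    m∣z : ∀ j → m ∣ z j
    m∣z Fin.zero                     = proj₁ (aniso z₀ z₁ z₂ n∣form)
    m∣z (Fin.suc Fin.zero)           = proj₁ (proj₂ (aniso z₀ z₁ z₂ n∣form))
    m∣z (Fin.suc (Fin.suc Fin.zero)) = proj₂ (proj₂ (aniso z₀ z₁ z₂ n∣form))

corollary4 : (n m : ℕ) → .{{ _ : NonZero n }} → n ≡ m * m → 2 ∣ n →
    D-is n (SqStar n) 4 × C-is n (SqStar n) 4
corollary4 .(m * m) m refl 2∣n =
  (s≤s z≤n , C⇒D {A = SqStar (m * m)} upper , lower) ,
  (s≤s z≤n , upper , λ j 1≤j j<4 → lower j 1≤j j<4 ∘ C⇒D {A = SqStar (m * m)})
  where
  upper : CProp (m * m) (SqStar (m * m)) 4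
  upper = C-upperBound-evenSquare m (prime-∣-square prime[2] 2∣n)
  lower : ∀ j → 1 ≤ j → j < 4 → ¬ DProp (m * m) (SqStar (m * m)) j
  lower j _ j<4 = D-lowerBound m ∘ DProp-mono {A = SqStar (m * m)} (≤⇒≤′ (s≤s⁻¹ j<4))
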